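{- Let $\mathcal{M}$ be a Carlson model and let a rule instance of $\mathrm{labCS}^\infty$ with conclusion $\mathfrak{S}$ and at least one premiss $\mathfrak{S}_1,\dots,\mathfrak{S}_n$ ($n\ge 1$) be given. Then $\mathcal{M}\Vdash\mathfrak{S}$ if and only if $\mathcal{M}\Vdash\mathfrak{S}_i$ for all $1\le i\le n$.
   Context: Formulas are built from a countable set $\mathtt{Prop}$ of propositional atoms by $A::=\bot\mid p\mid A\to A\mid\Box A\mid\triangle A$. A Carlson model is $\mathcal{M}=\langle W,\prec,M_0,M_1,V\rangle$ with $W$ a non-empty set, $\prec\subseteq W\times W$ transitive and conversely wellfounded (no infinite chain $w_0\prec w_1\prec\cdots$), $M_0,M_1\subseteq W$, and $V:\mathtt{Prop}\to\mathcal{P}(W)$. Truth: $\mathcal{M},x\nVdash\bot$; $\mathcal{M},x\Vdash p$ iff $x\in V(p)$; $\mathcal{M},x\Vdash A\to B$ iff $\mathcal{M},x\nVdash A$ or $\mathcal{M},x\Vdash B$; $\mathcal{M},x\Vdash\Box A$ iff $\mathcal{M},y\Vdash A$ for all $y$ with $x\prec y$ and $y\in M_0$; $\mathcal{M},x\Vdash\triangle A$ iff $\mathcal{M},y\Vdash A$ for all $y$ with $x\prec y$ and $y\in M_1$. Labelled sequents: fix a countable set $\mathtt{Lab}$ of labels. A labelled formula is $x:A$ ($x\in\mathtt{Lab}$, $A$ a formula); a relational atom is $xRy$ or $xSy$ ($x,y\in\mathtt{Lab}$). A sequent $\mathfrak{S}=\mathcal{R},\Gamma\Rightarrow\Omega$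 consists of a finite multiset $\mathcal{R}$ of relational atoms and finite multisets $\Gamma,\Omega$ of labelled formulas; commas denote multiset union; $Lab(\mathfrak{S})$ is the set of labels occurring in $\mathfrak{S}$. The rules of $\mathrm{labCS}^\infty$ (premisses / conclusion) are: (Id) no premiss, conclusion $\mathcal{R},\Gamma,x:p\Rightarrow x:p,\Omega$ with $p\in\mathtt{Prop}$; ($\bot$) no premiss, conclusion $\mathcal{R},\Gamma,x:\bot\Rightarrow\Omega$; ($\to$R) from $\mathcal{R},\Gamma,x:A\Rightarrow x:B,\Omega$ infer $\mathcal{R},\Gamma\Rightarrow x:A\to B,\Omega$; ($\to$L) from $\mathcal{R},\Gamma\Rightarrow x:A,\Omega$ and $\mathcal{R},\Gamma,x:B\Rightarrow\Omega$ infer $\mathcal{R},\Gamma,x:A\to B\Rightarrow\Omega$; ($\Box$R) from $\mathcal{R},xRy,\Gamma\Rightarrow y:A,\Omega$ infer $\mathcal{R},\Gamma\Rightarrow x:\Box A,\Omega$, where $y$ does not occur in the conclusion; ($\Box$L) from $\mathcal{R},xRy,x:\Box A,y:A,\Gamma\Rightarrow\Omega$ infer $\mathcal{R},xRy,x:\Box A,\Gamma\Rightarrow\Omega$; ($\triangle$R) from $\mathcal{R},xSy,\Gamma\Rightarrow y:A,\Omega$ infer $\mathcal{R},\Gamma\Rightarrow x:\triangle A,\Omega$, where $y$ does not occur in the conclusion; ($\triangle$L) from $\mathcal{R},xSy,x:\triangle A,y:A,\Gamma\Rightarrow\Omega$ infer $\mathcal{R},xSy,x:\triangle A,\Gamma\Rightarrow\Omega$;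 ($\mathrm{trans}_{\circ\bullet}$, for each $\circ,\bullet\in\{R,S\}$) from $\mathcal{R},x\circ y,y\bullet z,x\bullet z,\Gamma\Rightarrow\Omega$ infer $\mathcal{R},x\circ y,y\bullet z,\Gamma\Rightarrow\Omega$. A sequent interpretation of $\mathfrak{S}=\mathcal{R},\Gamma\Rightarrow\Omega$ on $\mathcal{M}$ is a map $I:Lab(\mathfrak{S})\to W$ such that $xRy\in\mathcal{R}$ implies $I(x)\prec I(y)$ and $I(y)\in M_0$, and $xSy\in\mathcal{R}$ implies $I(x)\prec I(y)$ and $I(y)\in M_1$. We write $\mathcal{M}\Vdash\mathfrak{S}$ if for every sequent interpretation $I$ of $\mathfrak{S}$ on $\mathcal{M}$: whenever $\mathcal{M},I(x)\Vdash A$ for all $x:A\in\Gamma$, there is $y:B\in\Omega$ with $\mathcal{M},I(y)\Vdash B$; otherwise $\mathcal{M}\nVdash\mathfrak{S}$. -}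

module Defs where

open import Level using (0ℓ)
open import Data.Nat using (ℕ; suc; _≡ᵇ_)
open import Data.Bool using (Bool; true; false; T; _∨_)
open import Data.List using (List; []; _∷_)
open import Data.Bool.ListAction using (any)
open import Data.List.Membership.Propositional using (_∈_)
open import Data.List.Relation.Binary.Permutation.Propositional using (_↭_)
open import Data.List.Relation.Binary.Pointwise using (Pointwise)
open import Data.Product using (Σ; _×_; _,_; ∃)
open import Data.Sum using (_⊎_)
open import Data.Empty renaming (⊥ to Empty)
open import Relation.Nullary using (¬_)
open import Relation.Binary.PropositionalEquality using (_≡_)

Atom : Set
Atom = ℕ

data Form : Set where
  ⊥'   : Form
  atom : Atom → Form
  _⇒_  : Form → Form → Form
  □_   : Form → Form
  △_   : Form → Form

infixr 5 _⇒_

record CarlsonModel : Set₁ where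
  field
    W      : Set
    inhabited : W
    _≺_    : W → W → Set
    trans  : ∀ {x y z} → x ≺ y → y ≺ z → x ≺ z
    -- conversely wellfounded: no infinite chain w₀ ≺ w₁ ≺ ⋯
    cwf    : ¬ (Σ (ℕ → W) λ f → ∀ n → f n ≺ f (suc n))
    M₀     : W → Set
    M₁     : W → Set
    V      : Atom → W → Set

  _⊩_ : W → Form → Set
  x ⊩ ⊥'       = Empty
  x ⊩ atom p   = V p x
  x ⊩ (A ⇒ B)  = (¬ (x ⊩ A)) ⊎ (x ⊩ B)
  x ⊩ (□ A)    = ∀ y → x ≺ y → M₀ y → y ⊩ A
  x ⊩ (△ A)    = ∀ y → x ≺ y → M₁ y → y ⊩ A

-- Labelled sequents  (Lab = ℕ; multisets represented as lists,
-- identified up to permutation, see Instance below)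

Lab : Set
Lab = ℕ

data Kind : Set where
  R S : Kind

record RelAtom : Set where
  constructor ⟨_∶_,_⟩
  field
    kind : Kind
    src  : Lab
    tgt  : Lab

record LForm : Set where
  constructor _∶_
  field
    lab  : Lab
    form : Form

infix 4 _∶_

record Sequent : Set where
  constructor _∣_⇒ₛ_
  field
    rels : List RelAtom
    ant  : List LForm
    succ : List LForm

infix 3 _∣_⇒ₛ_

-- Lab(𝔖) as a boolean occurrence test
occursRel : Lab → RelAtom → Bool
occursRel z ⟨ _ ∶ x , y ⟩ = (z ≡ᵇ x) ∨ (z ≡ᵇ y)

occursLF : Lab → LForm → Bool
occursLF z (x ∶ _) = z ≡ᵇ x

occurs : Lab → Sequent → Bool
occurs z (ℛ ∣ Γ ⇒ₛ Ω) = any (occursRel z) ℛ ∨ (any (occursLF z) Γ ∨ any (occursLF z) Ω)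

_∈Lab_ : Lab → Sequent → Set
z ∈Lab 𝔖 = T (occurs z 𝔖)

-- Rules of labCS^∞ (canonical list arrangement; principal parts first)

data Rule : List Sequent → Sequent → Set where
  Id   : ∀ ℛ Γ Ω x p →
         Rule [] (ℛ ∣ (x ∶ atom p) ∷ Γ ⇒ₛ (x ∶ atom p) ∷ Ω)
  ⊥L   : ∀ ℛ Γ Ω x →
         Rule [] (ℛ ∣ (x ∶ ⊥') ∷ Γ ⇒ₛ Ω)
  ⇒R   : ∀ ℛ Γ Ω x A B →
         Rule ((ℛ ∣ (x ∶ A) ∷ Γ ⇒ₛ (x ∶ B) ∷ Ω) ∷ [])
              (ℛ ∣ Γ ⇒ₛ (x ∶ A ⇒ B) ∷ Ω)
  ⇒L   : ∀ ℛ Γ Ω x A B →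
         Rule ((ℛ ∣ Γ ⇒ₛ (x ∶ A) ∷ Ω) ∷ (ℛ ∣ (x ∶ B) ∷ Γ ⇒ₛ Ω) ∷ [])
              (ℛ ∣ (x ∶ A ⇒ B) ∷ Γ ⇒ₛ Ω)
  □R   : ∀ ℛ Γ Ω x y A →
         occurs y (ℛ ∣ Γ ⇒ₛ (x ∶ □ A) ∷ Ω) ≡ false →
         Rule ((⟨ R ∶ x , y ⟩ ∷ ℛ ∣ Γ ⇒ₛ (y ∶ A) ∷ Ω) ∷ [])
              (ℛ ∣ Γ ⇒ₛ (x ∶ □ A) ∷ Ω)
  □L   : ∀ ℛ Γ Ω x y A →
         Rule ((⟨ R ∶ x , y ⟩ ∷ ℛ ∣ (x ∶ □ A) ∷ (y ∶ A) ∷ Γ ⇒ₛ Ω) ∷ [])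
              (⟨ R ∶ x , y ⟩ ∷ ℛ ∣ (x ∶ □ A) ∷ Γ ⇒ₛ Ω)
  △R   : ∀ ℛ Γ Ω x y A →
         occurs y (ℛ ∣ Γ ⇒ₛ (x ∶ △ A) ∷ Ω) ≡ false →
         Rule ((⟨ S ∶ x , y ⟩ ∷ ℛ ∣ Γ ⇒ₛ (y ∶ A) ∷ Ω) ∷ [])
              (ℛ ∣ Γ ⇒ₛ (x ∶ △ A) ∷ Ω)
  △L   : ∀ ℛ Γ Ω x y A →
         Rule ((⟨ S ∶ x , y ⟩ ∷ ℛ ∣ (x ∶ △ A) ∷ (y ∶ A) ∷ Γ ⇒ₛ Ω) ∷ [])
              (⟨ S ∶ x , y ⟩ ∷ ℛ ∣ (x ∶ △ A) ∷ Γ ⇒ₛ Ω)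
  trans : ∀ (∘ ∙ : Kind) ℛ Γ Ω x y z →
         Rule ((⟨ ∘ ∶ x , y ⟩ ∷ ⟨ ∙ ∶ y , z ⟩ ∷ ⟨ ∙ ∶ x , z ⟩ ∷ ℛ ∣ Γ ⇒ₛ Ω) ∷ [])
              (⟨ ∘ ∶ x , y ⟩ ∷ ⟨ ∙ ∶ y , z ⟩ ∷ ℛ ∣ Γ ⇒ₛ Ω)

_≈ₛ_ : Sequent → Sequent → Set
(ℛ ∣ Γ ⇒ₛ Ω) ≈ₛ (ℛ' ∣ Γ' ⇒ₛ Ω') = (ℛ ↭ ℛ') × (Γ ↭ Γ') × (Ω ↭ Ω')

Instance : List Sequent → Sequent → Set
Instance ps c = Σ (List Sequent) λ ps' → Σ Sequent λ c' →
  Rule ps' c' × Pointwise _≈ₛ_ ps ps' × (c ≈ₛ c')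

module _ (𝓜 : CarlsonModel) where
  open CarlsonModel 𝓜

  relHolds : Kind → W → W → Set
  relHolds R u v = (u ≺ v) × M₀ v
  relHolds S u v = (u ≺ v) × M₁ v

  record Interp (𝔖 : Sequent) : Set where
    field
      I    : (x : Lab) → x ∈Lab 𝔖 → W
      resp : ∀ k x y → ⟨ k ∶ x , y ⟩ ∈ Sequent.rels 𝔖 →
             (px : x ∈Lab 𝔖) (py : y ∈Lab 𝔖) → relHolds k (I x px) (I y py)

  Valid : Sequent → Set
  Valid 𝔖 = (ι : Interp 𝔖) →
    let open Interp ι in
    (∀ x A → (x ∶ A) ∈ Sequent.ant 𝔖 → (px : x ∈Lab 𝔖) → I x px ⊩ A) →
    Σ Lab λ y → Σ Form λ B → ((y ∶ B) ∈ Sequent.succ 𝔖) ×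
      Σ (y ∈Lab 𝔖) λ py → I y py ⊩ B

{-# OPTIONS --safe #-}
-- Validity is first rephrased with total valuations Lab → W: an interpretation of Lab(𝔖)
-- extends to one (this is where W ≠ ∅ is used), and conversely only the labels of 𝔖 matter.
-- Truth under a valuation only tests membership in the three components, so it is invariant
-- under permutations. Every rule except □R/△R is then sound and invertible valuation by
-- valuation (classically, for the implication rules). For □R/△R, invertibility is again
-- local, while soundness uses that the eigenvariable y is fresh: if the conclusion were
-- false under f, then for each world w accessible from f x the valuation f[y ↦ w] still
-- falsifies the context, so the premiss forces A at w, whence □A (△A) holds at f x after all.

module Submission where

open import Defs
open import Level using (0ℓ)
open import Axiom.ExcludedMiddle using (ExcludedMiddle)
open import Data.Bool using (Bool; true; false; T; _∨_)
open import Data.Bool.ListAction using (any)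
open import Data.Bool.Properties using (T-∨)
open import Data.Nat using (_≡ᵇ_; _≟_)
open import Data.Nat.Properties using (≡⇒≡ᵇ)
open import Data.List using (List; []; _∷_)
open import Data.List.Relation.Unary.All as All using (All; []; _∷_)
open import Data.List.Relation.Unary.Any using (Any; here; there)
open import Data.List.Relation.Unary.Any.Properties using (any⁺)
open import Data.List.Membership.Propositional using (_∈_; lose; find)
open import Data.List.Relation.Binary.Permutation.Propositional using (↭-sym)
open import Data.List.Relation.Binary.Permutation.Propositional.Properties using (All-resp-↭; Any-resp-↭)
open import Data.List.Relation.Binary.Pointwise using (Pointwise; []; _∷_)
open import Data.Product using (_,_; proj₁; curry; uncurry)
open import Data.Sum using (inj₁; inj₂)
open import Data.Unit using (tt)
open import Function using (_∘_; const)
open import Function.Bundles using (_⇔_; mk⇔; Equivalence)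
open import Function.Related.Propositional using (module EquationalReasoning; equivalence)
open import Function.Construct.Symmetry using (⇔-sym)
open import Relation.Nullary using (¬_; yes; no; contradiction)
open import Relation.Binary.PropositionalEquality using (_≡_; _≢_; refl; sym; subst; subst₂)

open Equivalence using (to; from)
open RelAtom using (src; tgt)
open LForm using (lab; form)

private
  variable
    ℛ : List RelAtom
    Γ Ω : List LForm
    𝔖 𝔗 : Sequent
    ps : List Sequent
    k : Kind
    x y z : Lab
    A B : Form

T-∨ˡ : ∀ {a b} → T a → T (a ∨ b)
T-∨ˡ t = from T-∨ (inj₁ t)

T-∨ʳ : ∀ a {b} → T b → T (a ∨ b)
T-∨ʳ a t = from (T-∨ {a}) (inj₂ t)

∈Lab-rels : ∀ {ℛ Γ Ω z a} → a ∈ ℛ → T (occursRel z a) → z ∈Lab (ℛ ∣ Γ ⇒ₛ Ω)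
∈Lab-rels a∈ℛ t = T-∨ˡ (any⁺ _ (lose a∈ℛ t))

src∈Lab : ∀ {ℛ Γ Ω a} → a ∈ ℛ → src a ∈Lab (ℛ ∣ Γ ⇒ₛ Ω)
src∈Lab {Γ = Γ} {Ω} {a} a∈ℛ =
  ∈Lab-rels {Γ = Γ} {Ω} {src a} a∈ℛ (T-∨ˡ (≡⇒≡ᵇ (src a) _ refl))

tgt∈Lab : ∀ {ℛ Γ Ω a} → a ∈ ℛ → tgt a ∈Lab (ℛ ∣ Γ ⇒ₛ Ω)
tgt∈Lab {Γ = Γ} {Ω} {a} a∈ℛ =
  ∈Lab-rels {Γ = Γ} {Ω} {tgt a} a∈ℛ (T-∨ʳ (tgt a ≡ᵇ src a) (≡⇒≡ᵇ (tgt a) _ refl))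

ant∈Lab : ∀ {ℛ Γ Ω φ} → φ ∈ Γ → lab φ ∈Lab (ℛ ∣ Γ ⇒ₛ Ω)
ant∈Lab {ℛ} {φ = φ} φ∈Γ =
  T-∨ʳ (any (occursRel (lab φ)) ℛ) (T-∨ˡ (any⁺ _ (lose φ∈Γ (≡⇒≡ᵇ (lab φ) _ refl))))

succ∈Lab : ∀ {ℛ Γ Ω φ} → φ ∈ Ω → lab φ ∈Lab (ℛ ∣ Γ ⇒ₛ Ω)
succ∈Lab {ℛ} {Γ} {φ = φ} φ∈Ω =
  T-∨ʳ (any (occursRel (lab φ)) ℛ)
    (T-∨ʳ (any (occursLF (lab φ)) Γ) (any⁺ _ (lose φ∈Ω (≡⇒≡ᵇ (lab φ) _ refl))))

fresh-≢ : occurs y 𝔖 ≡ false → z ∈Lab 𝔖 → z ≢ y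
fresh-≢ fresh z∈𝔖 refl = subst T fresh z∈𝔖

default : ∀ {C : Set} {b : Bool} → C → (T b → C) → C
default {b = true}  _ g = g tt
default {b = false} c _ = c

default-≡ : ∀ {C : Set} {b : Bool} (c : C) (g : T b → C) (t : T b) → default c g ≡ g t
default-≡ {b = true} _ _ _ = refl

_[_↦_] : ∀ {C : Set} → (Lab → C) → Lab → C → Lab → C
(f [ y ↦ c ]) z with z ≟ y
... | yes _ = c
... | no  _ = f z

[↦]-same : ∀ {C : Set} (f : Lab → C) y {c} → (f [ y ↦ c ]) y ≡ c
[↦]-same f y with y ≟ y
... | yes _   = refl
... | no  y≢y = contradiction refl y≢y

[↦]-other : ∀ {C : Set} (f : Lab → C) {c} → z ≢ y → (f [ y ↦ c ]) z ≡ f z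
[↦]-other {z = z} {y = y} f z≢y with z ≟ y
... | yes z≡y = contradiction z≡y z≢y
... | no  _   = refl

modal : Kind → Form → Form
modal R = □_
modal S = △_

≈ₛ-sym : 𝔖 ≈ₛ 𝔗 → 𝔗 ≈ₛ 𝔖
≈ₛ-sym (ℛ↭ , Γ↭ , Ω↭) = ↭-sym ℛ↭ , ↭-sym Γ↭ , ↭-sym Ω↭

Pointwise-≢[] : ∀ {a r} {C : Set a} {_∼_ : C → C → Set r} {xs ys} →
                Pointwise _∼_ xs ys → xs ≢ [] → ys ≢ []
Pointwise-≢[] []      xs≢[] = xs≢[]
Pointwise-≢[] (_ ∷ _) _     = λ ()

All-Pointwise-⇔ : ∀ {a b r p q} {I : Set a} {J : Set b} {_∼_ : I → J → Set r}
                    {P : I → Set p} {Q : J → Set q} {xs ys} →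
                  (∀ {i j} → i ∼ j → P i ⇔ Q j) →
                  Pointwise _∼_ xs ys → All P xs ⇔ All Q ys
All-Pointwise-⇔ _   []       = mk⇔ (const []) (const [])
All-Pointwise-⇔ P⇔Q (i∼j ∷ rest) = mk⇔
  (λ { (p ∷ ps) → to (P⇔Q i∼j) p ∷ to (All-Pointwise-⇔ P⇔Q rest) ps })
  (λ { (q ∷ qs) → from (P⇔Q i∼j) q ∷ from (All-Pointwise-⇔ P⇔Q rest) qs })

module Semantics (𝓜 : CarlsonModel) where
  open CarlsonModel 𝓜 using (W; inhabited; _≺_; _⊩_) renaming (trans to ≺-trans)

  Valuation : Set
  Valuation = Lab → W

  Holds : Valuation → RelAtom → Set
  Holds f ⟨ k ∶ x , y ⟩ = relHolds 𝓜 k (f x) (f y)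

  Sat : Valuation → LForm → Set
  Sat f (x ∶ A) = f x ⊩ A

  infix 4 _⊩ₛ_ ⊨_ _≐_on_

  _⊩ₛ_ : Valuation → Sequent → Set
  f ⊩ₛ (ℛ ∣ Γ ⇒ₛ Ω) = All (Holds f) ℛ → All (Sat f) Γ → Any (Sat f) Ω

  ⊨_ : Sequent → Set
  ⊨ 𝔖 = ∀ f → f ⊩ₛ 𝔖

  record _≐_on_ (f g : Valuation) (𝔖 : Sequent) : Set where
    constructor agree
    field at : ∀ z → z ∈Lab 𝔖 → f z ≡ g z

  open _≐_on_

  ≐-sym : ∀ {f g} → f ≐ g on 𝔖 → g ≐ f on 𝔖
  ≐-sym f≐g = agree λ z z∈𝔖 → sym (at f≐g z z∈𝔖)

  relHolds⇒≺ : ∀ k {u v} → relHolds 𝓜 k u v → u ≺ v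
  relHolds⇒≺ R = proj₁
  relHolds⇒≺ S = proj₁

  relHolds-trans : ∀ {k l u v w} → relHolds 𝓜 k u v → relHolds 𝓜 l v w → relHolds 𝓜 l u w
  relHolds-trans {k} {R} u→v (v≺w , w∈M₀) = ≺-trans (relHolds⇒≺ k u→v) v≺w , w∈M₀
  relHolds-trans {k} {S} u→v (v≺w , w∈M₁) = ≺-trans (relHolds⇒≺ k u→v) v≺w , w∈M₁

  ⊩-modal : ∀ {u} → u ⊩ modal k A ⇔ (∀ v → relHolds 𝓜 k u v → v ⊩ A)
  ⊩-modal {R} = mk⇔ (λ h v → uncurry (h v)) (λ h v → curry (h v))
  ⊩-modal {S} = mk⇔ (λ h v → uncurry (h v)) (λ h v → curry (h v))

  rels-agree : ∀ {f g} → f ≐ g on (ℛ ∣ Γ ⇒ₛ Ω) → All (Holds f) ℛ → All (Holds g) ℛ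
  rels-agree {Γ = Γ} {Ω = Ω} f≐g hs = All.tabulate λ {a} a∈ℛ →
    subst₂ (relHolds 𝓜 (RelAtom.kind a))
      (at f≐g _ (src∈Lab {Γ = Γ} {Ω} a∈ℛ)) (at f≐g _ (tgt∈Lab {Γ = Γ} {Ω} a∈ℛ))
      (All.lookup hs a∈ℛ)

  ant-agree : ∀ {f g} → f ≐ g on (ℛ ∣ Γ ⇒ₛ Ω) → All (Sat f) Γ → All (Sat g) Γ
  ant-agree {ℛ = ℛ} {Ω = Ω} f≐g γ = All.tabulate λ {φ} φ∈Γ →
    subst (_⊩ form φ) (at f≐g _ (ant∈Lab {ℛ = ℛ} {Ω = Ω} φ∈Γ)) (All.lookup γ φ∈Γ)

  succ-agree : ∀ {f g} → f ≐ g on (ℛ ∣ Γ ⇒ₛ Ω) → Any (Sat f) Ω → Any (Sat g) Ω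
  succ-agree {ℛ = ℛ} {Γ = Γ} f≐g ω with find ω
  ... | φ , φ∈Ω , t = lose φ∈Ω (subst (_⊩ form φ) (at f≐g _ (succ∈Lab {ℛ = ℛ} {Γ = Γ} φ∈Ω)) t)

  [↦]-fresh : ∀ f {w} → occurs y 𝔖 ≡ false → f ≐ f [ y ↦ w ] on 𝔖
  [↦]-fresh {𝔖 = 𝔖} f fresh = agree λ _ z∈𝔖 → sym ([↦]-other f (fresh-≢ {𝔖 = 𝔖} fresh z∈𝔖))

  Valid⇒⊨ : Valid 𝓜 𝔖 → ⊨ 𝔖
  Valid⇒⊨ {𝔖} v f hs γ =
    let _ , _ , φ∈Ω , _ , t = v interpretation (λ _ _ φ∈Γ _ → All.lookup γ φ∈Γ) in lose φ∈Ω t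
    where
      interpretation : Interp 𝓜 𝔖
      interpretation = record { I = λ x _ → f x ; resp = λ _ _ _ a∈ℛ _ _ → All.lookup hs a∈ℛ }

  ⊨⇒Valid : ⊨ 𝔖 → Valid 𝓜 𝔖
  ⊨⇒Valid {𝔖 = ℛ ∣ Γ ⇒ₛ Ω} v ι sat =
    let φ , φ∈Ω , t = find (v f holds (All.tabulate sat-ant))
        p = succ∈Lab {ℛ = ℛ} {Γ = Γ} φ∈Ω
    in lab φ , form φ , φ∈Ω , p , subst (_⊩ form φ) (f≡I _ p) t
    where
      open Interp ι
      f : Valuation
      f x = default inhabited (I x)
      f≡I : ∀ x (p : x ∈Lab (ℛ ∣ Γ ⇒ₛ Ω)) → f x ≡ I x p
      f≡I x = default-≡ inhabited (I x)
      holds : All (Holds f) ℛ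
      holds = All.tabulate λ {a} a∈ℛ →
        let px = src∈Lab {Γ = Γ} {Ω = Ω} a∈ℛ ; py = tgt∈Lab {Γ = Γ} {Ω = Ω} a∈ℛ in
        subst₂ (relHolds 𝓜 (RelAtom.kind a)) (sym (f≡I _ px)) (sym (f≡I _ py))
          (resp _ _ _ a∈ℛ px py)
      sat-ant : ∀ {φ} → φ ∈ Γ → Sat f φ
      sat-ant {φ} φ∈Γ = let p = ant∈Lab {ℛ = ℛ} {Ω = Ω} φ∈Γ in
        subst (_⊩ form φ) (sym (f≡I _ p)) (sat _ _ φ∈Γ p)

  ⊨-resp-≈ₛ : 𝔖 ≈ₛ 𝔗 → ⊨ 𝔖 → ⊨ 𝔗
  ⊨-resp-≈ₛ {_ ∣ _ ⇒ₛ _} {_ ∣ _ ⇒ₛ _} (ℛ↭ , Γ↭ , Ω↭) v f hs γ =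
    Any-resp-↭ Ω↭ (v f (All-resp-↭ (↭-sym ℛ↭) hs) (All-resp-↭ (↭-sym Γ↭) γ))

  Valid⇔⊨ : 𝔖 ≈ₛ 𝔗 → Valid 𝓜 𝔖 ⇔ ⊨ 𝔗
  Valid⇔⊨ 𝔖≈𝔗 = mk⇔ (⊨-resp-≈ₛ 𝔖≈𝔗 ∘ Valid⇒⊨) (⊨⇒Valid ∘ ⊨-resp-≈ₛ (≈ₛ-sym 𝔖≈𝔗))

  ⊨-pointwise : ∀ {𝔖 ps} → (∀ f → f ⊩ₛ 𝔖 ⇔ All (f ⊩ₛ_) ps) → ⊨ 𝔖 ⇔ All ⊨_ ps
  ⊨-pointwise local = mk⇔
    (λ v → All.tabulate λ 𝔗∈ps f → All.lookup (to (local f) (v f)) 𝔗∈ps)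
    (λ vs f → from (local f) (All.map (λ v → v f) vs))

  trans-⊩ₛ : ∀ {f} k l →
    f ⊩ₛ (⟨ k ∶ x , y ⟩ ∷ ⟨ l ∶ y , z ⟩ ∷ ℛ ∣ Γ ⇒ₛ Ω) ⇔
    All (f ⊩ₛ_) ((⟨ k ∶ x , y ⟩ ∷ ⟨ l ∶ y , z ⟩ ∷ ⟨ l ∶ x , z ⟩ ∷ ℛ ∣ Γ ⇒ₛ Ω) ∷ [])
  trans-⊩ₛ _ _ = mk⇔
    (λ v → (λ { (xy ∷ yz ∷ _ ∷ hs) → v (xy ∷ yz ∷ hs) }) ∷ [])
    (λ { (v ∷ []) (xy ∷ yz ∷ hs) → v (xy ∷ yz ∷ relHolds-trans xy yz ∷ hs) })

  modalL-⊩ₛ : ∀ {f} →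
    f ⊩ₛ (⟨ k ∶ x , y ⟩ ∷ ℛ ∣ (x ∶ modal k A) ∷ Γ ⇒ₛ Ω) ⇔
    All (f ⊩ₛ_) ((⟨ k ∶ x , y ⟩ ∷ ℛ ∣ (x ∶ modal k A) ∷ (y ∶ A) ∷ Γ ⇒ₛ Ω) ∷ [])
  modalL-⊩ₛ = mk⇔
    (λ v → (λ { hs (x⊩A ∷ _ ∷ γ) → v hs (x⊩A ∷ γ) }) ∷ [])
    (λ { (v ∷ []) hs@(xy ∷ _) (x⊩A ∷ γ) → v hs (x⊩A ∷ to ⊩-modal x⊩A _ xy ∷ γ) })

  module _ (em : ExcludedMiddle 0ℓ) where

    ⇒R-⊩ₛ : ∀ {f} →
      f ⊩ₛ (ℛ ∣ Γ ⇒ₛ (x ∶ A ⇒ B) ∷ Ω) ⇔ All (f ⊩ₛ_) ((ℛ ∣ (x ∶ A) ∷ Γ ⇒ₛ (x ∶ B) ∷ Ω) ∷ [])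
    ⇒R-⊩ₛ {ℛ} {Γ} {x} {A} {B} {Ω} {f} = mk⇔ (λ v → invert v ∷ []) (λ { (v ∷ []) → sound v })
      where
        invert : f ⊩ₛ (ℛ ∣ Γ ⇒ₛ (x ∶ A ⇒ B) ∷ Ω) → f ⊩ₛ (ℛ ∣ (x ∶ A) ∷ Γ ⇒ₛ (x ∶ B) ∷ Ω)
        invert v hs (a ∷ γ) with v hs γ
        ... | here (inj₁ ¬a) = contradiction a ¬a
        ... | here (inj₂ b)  = here b
        ... | there ω        = there ω
        sound : f ⊩ₛ (ℛ ∣ (x ∶ A) ∷ Γ ⇒ₛ (x ∶ B) ∷ Ω) → f ⊩ₛ (ℛ ∣ Γ ⇒ₛ (x ∶ A ⇒ B) ∷ Ω)
        sound v hs γ with em {f x ⊩ A}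
        ... | no ¬a = here (inj₁ ¬a)
        ... | yes a with v hs (a ∷ γ)
        ...   | here b  = here (inj₂ b)
        ...   | there ω = there ω

    ⇒L-⊩ₛ : ∀ {f} →
      f ⊩ₛ (ℛ ∣ (x ∶ A ⇒ B) ∷ Γ ⇒ₛ Ω) ⇔
      All (f ⊩ₛ_) ((ℛ ∣ Γ ⇒ₛ (x ∶ A) ∷ Ω) ∷ (ℛ ∣ (x ∶ B) ∷ Γ ⇒ₛ Ω) ∷ [])
    ⇒L-⊩ₛ {ℛ} {x} {A} {B} {Γ} {Ω} {f} =
      mk⇔ (λ v → invertˡ v ∷ (λ { hs (b ∷ γ) → v hs (inj₂ b ∷ γ) }) ∷ [])
          (λ { (v₁ ∷ v₂ ∷ []) → sound v₁ v₂ })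
      where
        invertˡ : f ⊩ₛ (ℛ ∣ (x ∶ A ⇒ B) ∷ Γ ⇒ₛ Ω) → f ⊩ₛ (ℛ ∣ Γ ⇒ₛ (x ∶ A) ∷ Ω)
        invertˡ v hs γ with em {f x ⊩ A}
        ... | yes a = here a
        ... | no ¬a = there (v hs (inj₁ ¬a ∷ γ))
        sound : f ⊩ₛ (ℛ ∣ Γ ⇒ₛ (x ∶ A) ∷ Ω) → f ⊩ₛ (ℛ ∣ (x ∶ B) ∷ Γ ⇒ₛ Ω) →
                f ⊩ₛ (ℛ ∣ (x ∶ A ⇒ B) ∷ Γ ⇒ₛ Ω)
        sound _  v₂ hs (inj₂ b ∷ γ) = v₂ hs (b ∷ γ)
        sound v₁ _  hs (inj₁ ¬a ∷ γ) with v₁ hs γ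
        ... | here a  = contradiction a ¬a
        ... | there ω = ω

    modalR-sound : occurs y (ℛ ∣ Γ ⇒ₛ (x ∶ modal k A) ∷ Ω) ≡ false →
      ⊨ (⟨ k ∶ x , y ⟩ ∷ ℛ ∣ Γ ⇒ₛ (y ∶ A) ∷ Ω) → ⊨ (ℛ ∣ Γ ⇒ₛ (x ∶ modal k A) ∷ Ω)
    modalR-sound {y} {ℛ} {Γ} {x} {k} {A} {Ω} fresh v f hs γ
      with em {Any (Sat f) ((x ∶ modal k A) ∷ Ω)}
    ... | yes ω = ω
    ... | no ¬ω = contradiction (here (from ⊩-modal x⊩A)) ¬ω
      where
        x⊩A : ∀ w → relHolds 𝓜 k (f x) w → w ⊩ A
        x⊩A w xw = conclude (v g (xy ∷ rels-agree f≐g hs) (ant-agree f≐g γ))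
          where
            g : Valuation
            g = f [ y ↦ w ]
            f≐g : f ≐ g on (ℛ ∣ Γ ⇒ₛ (x ∶ modal k A) ∷ Ω)
            f≐g = [↦]-fresh f fresh
            xy : relHolds 𝓜 k (g x) (g y)
            xy = subst₂ (relHolds 𝓜 k) (at f≐g x x∈𝔖) (sym ([↦]-same f y)) xw
              where
                x∈𝔖 : x ∈Lab (ℛ ∣ Γ ⇒ₛ (x ∶ modal k A) ∷ Ω)
                x∈𝔖 = succ∈Lab {ℛ = ℛ} {Γ = Γ} {Ω = (x ∶ modal k A) ∷ Ω} (here refl)
            conclude : Any (Sat g) ((y ∶ A) ∷ Ω) → w ⊩ A
            conclude (here yA) = subst (_⊩ A) ([↦]-same f y) yA
            conclude (there ω) = contradiction (succ-agree (≐-sym f≐g) (there ω)) ¬ω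

    modalR-⊨ : occurs y (ℛ ∣ Γ ⇒ₛ (x ∶ modal k A) ∷ Ω) ≡ false →
      ⊨ (ℛ ∣ Γ ⇒ₛ (x ∶ modal k A) ∷ Ω) ⇔ All ⊨_ ((⟨ k ∶ x , y ⟩ ∷ ℛ ∣ Γ ⇒ₛ (y ∶ A) ∷ Ω) ∷ [])
    modalR-⊨ {y} {ℛ} {Γ} {x} {k} {A} {Ω} fresh =
      mk⇔ (λ v → invert v ∷ []) (λ { (v ∷ []) → modalR-sound fresh v })
      where
        invert : ⊨ (ℛ ∣ Γ ⇒ₛ (x ∶ modal k A) ∷ Ω) → ⊨ (⟨ k ∶ x , y ⟩ ∷ ℛ ∣ Γ ⇒ₛ (y ∶ A) ∷ Ω)
        invert v f (xy ∷ hs) γ with v f hs γ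
        ... | here x⊩A = here (to ⊩-modal x⊩A _ xy)
        ... | there ω = there ω

    ⊨-rule : ∀ {𝔖} → Rule ps 𝔖 → ps ≢ [] → ⊨ 𝔖 ⇔ All ⊨_ ps
    ⊨-rule (Id _ _ _ _ _)          ps≢[] = contradiction refl ps≢[]
    ⊨-rule (⊥L _ _ _ _)            ps≢[] = contradiction refl ps≢[]
    ⊨-rule (⇒R _ _ _ _ _ _)        _ = ⊨-pointwise λ _ → ⇒R-⊩ₛ
    ⊨-rule (⇒L _ _ _ _ _ _)        _ = ⊨-pointwise λ _ → ⇒L-⊩ₛ
    ⊨-rule (□R _ _ _ _ _ _ fresh)  _ = modalR-⊨ {k = R} fresh
    ⊨-rule (△R _ _ _ _ _ _ fresh)  _ = modalR-⊨ {k = S} fresh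
    ⊨-rule (□L _ _ _ _ _ _)        _ = ⊨-pointwise λ _ → modalL-⊩ₛ {k = R}
    ⊨-rule (△L _ _ _ _ _ _)        _ = ⊨-pointwise λ _ → modalL-⊩ₛ {k = S}
    ⊨-rule (trans k l _ _ _ _ _ _) _ = ⊨-pointwise λ _ → trans-⊩ₛ k l

lemma1 : ExcludedMiddle 0ℓ →
    (𝓜 : CarlsonModel) (ps : List Sequent) (c : Sequent) →
    Instance ps c → ¬ (ps ≡ []) →
    Valid 𝓜 c ⇔ All (Valid 𝓜) ps
lemma1 em 𝓜 ps c (ps′ , c′ , rule , ps≈ps′ , c≈c′) ps≢[] = begin
  Valid 𝓜 c       ∼⟨ Valid⇔⊨ c≈c′ ⟩
  ⊨ c′            ∼⟨ ⊨-rule em rule (Pointwise-≢[] ps≈ps′ ps≢[]) ⟩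
  All ⊨_ ps′      ∼⟨ ⇔-sym (All-Pointwise-⇔ Valid⇔⊨ ps≈ps′) ⟩
  All (Valid 𝓜) ps ∎
  where
    open Semantics 𝓜
    open EquationalReasoning {k = equivalence}
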